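{- For every positive integer $m$, there exists a convex set $A\subseteq \mathbb{R}$ with $|A| = 2m$ and a non-zero element $d \in A-A$ such that $r_{A-A}(d) \geq m$.
   Context: A finite set $A=\{a_1<a_2<\dots<a_n\} \subset \mathbb{R}$ is called convex if its consecutive differences are strictly increasing, i.e. $a_i - a_{i-1} < a_{i+1}-a_i$ for all $2 \le i \le n-1$. The difference set is $A-A=\{a-b : a,b\in A\}$, and for $x\in\mathbb{R}$, $r_{A-A}(x) = |\{(a,b)\in A\times A : a-b=x\}|$. -}

module Defs where

open import Data.Nat using (ℕ; suc; _<_)
open import Data.Integer using (ℤ) renaming (_-_ to _-ℤ_; _<_ to _<ℤ_)
import Data.Integer as ℤ
open import Data.Fin using (Fin; toℕ)
open import Data.List using (List; length; filter; cartesianProduct; allFin)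
open import Data.Product using (_×_; _,_; proj₁; proj₂; ∃₂)
open import Relation.Binary.PropositionalEquality using (_≡_)

-- A finite set A = {a_0 < a_1 < ... < a_{n-1}} ⊂ ℤ, given by its increasing enumeration.
StrictlyIncreasing : {n : ℕ} → (Fin n → ℤ) → Set
StrictlyIncreasing {n} a = ∀ (i j : Fin n) → toℕ i < toℕ j → a i <ℤ a j

ConvexDiffs : {n : ℕ} → (Fin n → ℤ) → Set
ConvexDiffs {n} a = ∀ (i j k : Fin n) → toℕ j ≡ suc (toℕ i) → toℕ k ≡ suc (toℕ j) →
  (a j -ℤ a i) <ℤ (a k -ℤ a j)

IsConvexSet : {n : ℕ} → (Fin n → ℤ) → Set
IsConvexSet a = StrictlyIncreasing a × ConvexDiffs a

InDiffSet : {n : ℕ} → (Fin n → ℤ) → ℤ → Set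
InDiffSet {n} a x = ∃₂ λ (i j : Fin n) → a i -ℤ a j ≡ x

-- r_{A-A}(x) = #{(a,b) ∈ A × A : a - b = x}; since a is injective, pairs of
-- elements correspond bijectively to pairs of indices.
rDiff : {n : ℕ} → (Fin n → ℤ) → ℤ → ℕ
rDiff {n} a x = length (filter (λ p → (a (proj₁ p) -ℤ a (proj₂ p)) ℤ.≟ x)
                               (cartesianProduct (allFin n) (allFin n)))

{-# OPTIONS --safe #-}
-- If a_m − a_0 = a_{m+t} − a_{2t} for all t < m, the pairs (a_{m+t}, a_{2t}) give m
-- representations of d = a_m − a_0. In terms of the gaps δ_k = a_{k+1} − a_k this is the
-- recursion δ_{m+t} = δ_{2t} + δ_{2t+1}, which determines the gaps beyond m from earlier ones.
-- Starting from δ_k = m + k for k < m, an increasing sequence with δ_{m-1} < δ_0 + δ_1, the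
-- recursion keeps the gaps strictly increasing: δ_{m+t} < δ_{m+t+1} compares the sums of the
-- consecutive pairs δ_{2t}, δ_{2t+1} and δ_{2t+2}, δ_{2t+3}. So the partial sums a_k are convex.
module Submission where

open import Defs
open import Data.Nat
open import Data.Nat.Properties
open import Data.Nat.Tactic.RingSolver using (solve-∀)
open import Data.Nat.Induction using (<-wellFounded; <-rec)
open import Data.Integer as ℤ using (ℤ; 0ℤ; +_; _⊖_)
import Data.Integer.Properties as ℤ
open import Data.Fin using (Fin; toℕ; fromℕ<)
open import Data.Fin.Properties using (toℕ<n; toℕ-fromℕ<; toℕ-injective; injective⇒≤)
open import Data.List using (List; length)
open import Data.List.Membership.Propositional using (_∈_)
open import Data.List.Membership.Propositional.Properties
  using (∈-filter⁺; ∈-cartesianProduct⁺; ∈-allFin)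
import Data.List.Membership.Setoid.Properties as Membership
open import Data.Product using (Σ; _×_; _,_; ∃; proj₁; proj₂)
open import Data.Sum using (inj₁; inj₂)
open import Function.Base using (_∘_)
open import Function.Definitions using (Injective)
open import Induction.WellFounded using (WfRec; module FixPoint)
open import Relation.Binary.PropositionalEquality
open import Relation.Nullary using (yes; no; contradiction)

injective⇒≤-length : ∀ {ℓ n} {A : Set ℓ} {xs : List A} (f : Fin n → A) →
                     Injective _≡_ _≡_ f → (∀ i → f i ∈ xs) → n ≤ length xs
injective⇒≤-length f f-inj f∈xs = injective⇒≤ λ {i} {j} eq →
  f-inj (Membership.index-injective (setoid _) (f∈xs i) (f∈xs j) eq)

+[m+n]-+m≡+n : ∀ m n → + (m + n) ℤ.- + m ≡ + n
+[m+n]-+m≡+n m n = begin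
  + (m + n) ℤ.- + m   ≡⟨ ℤ.[+m]-[+n]≡m⊖n (m + n) m ⟩
  (m + n) ⊖ m         ≡⟨ ℤ.⊖-≥ (m≤m+n m n) ⟩
  + (m + n ∸ m)       ≡⟨ cong +_ (m+n∸m≡n m n) ⟩
  + n                 ∎
  where open ≡-Reasoning

m+n<2m⇒n<m : ∀ {m n} → m + n < 2 * m → n < m
m+n<2m⇒n<m {m} {n} m+n<2m = +-cancelˡ-< m n m (subst (m + n <_) (cong (_+_ m) (+-identityʳ m)) m+n<2m)

n<m⇒m+n<2m : ∀ {m n} → n < m → m + n < 2 * m
n<m⇒m+n<2m {m} {n} n<m = subst (m + n <_) (cong (_+_ m) (sym (+-identityʳ m))) (+-monoʳ-< m n<m)

c+t<m⇒c+2t<m+t : ∀ {m} c {t} → c + t < m → c + 2 * t < m + t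
c+t<m⇒c+2t<m+t {m} c {t} c+t<m = subst (_< m + t) c+t+t≡c+2t (+-monoˡ-< t c+t<m)
  where
  c+t+t≡c+2t : c + t + t ≡ c + 2 * t
  c+t+t≡c+2t = trans (+-assoc c t t) (cong (λ s → c + (t + s)) (sym (+-identityʳ t)))

module Construction (m : ℕ) where

  -- The recursive call is well-founded only for k ≤ 2m − 2, which covers every gap of a
  -- 2m-element set; the value 0 beyond is junk.
  δ-step : ∀ k → WfRec _<_ (λ _ → ℕ) k → ℕ
  δ-step k δ< with k <? m | suc (2 * (k ∸ m)) <? k
  ... | yes _ | _       = m + k
  ... | no _  | yes c<k = δ< (<-trans (n<1+n _) c<k) + δ< c<k
  ... | no _  | no _    = 0

  δ-step-ext : ∀ k {δ< δ<′ : WfRec _<_ (λ _ → ℕ) k} →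
               (∀ {j} (j<k : j < k) → δ< j<k ≡ δ<′ j<k) → δ-step k δ< ≡ δ-step k δ<′
  δ-step-ext k eq with k <? m | suc (2 * (k ∸ m)) <? k
  ... | yes _ | _       = refl
  ... | no _  | yes c<k = cong₂ _+_ (eq _) (eq c<k)
  ... | no _  | no _    = refl

  opaque
    δ : ℕ → ℕ
    δ = <-rec (λ _ → ℕ) δ-step

    δ-unfold : ∀ k → δ k ≡ δ-step k (λ {j} _ → δ j)
    δ-unfold k = FixPoint.unfold-wfRec <-wellFounded (λ _ → ℕ) δ-step δ-step-ext

  δ-leaf : ∀ {k} → k < m → δ k ≡ m + k
  δ-leaf {k} k<m rewrite δ-unfold k with k <? m
  ... | yes _  = refl
  ... | no k≮m = contradiction k<m k≮m

  δ-node : ∀ {t} → suc t < m → δ (m + t) ≡ δ (2 * t) + δ (suc (2 * t))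
  δ-node {t} 1+t<m rewrite δ-unfold (m + t) with m + t <? m | suc (2 * (m + t ∸ m)) <? m + t
  ... | yes m+t<m | _     = contradiction m+t<m (m+n≮m m t)
  ... | no _      | yes _ = cong (λ s → δ (2 * s) + δ (suc (2 * s))) (m+n∸m≡n m t)
  ... | no _      | no c≮m+t = contradiction c<m+t c≮m+t
    where
    c<m+t : suc (2 * (m + t ∸ m)) < m + t
    c<m+t = subst (λ s → suc (2 * s) < m + t) (sym (m+n∸m≡n m t)) (c+t<m⇒c+2t<m+t 1 1+t<m)

  δ-increasing-leaf : ∀ {k} → suc k < m → δ k < δ (suc k)
  δ-increasing-leaf {k} 1+k<m =
    subst₂ _<_ (sym (δ-leaf (<-trans (n<1+n k) 1+k<m))) (sym (δ-leaf 1+k<m)) (+-monoʳ-< m (n<1+n k))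

  δ-increasing-boundary : ∀ {k} → suc k ≡ m → 1 < m → δ k < δ (suc k)
  δ-increasing-boundary {k} 1+k≡m 1<m = begin-strict
    δ k               ≡⟨ δ-leaf k<m ⟩
    m + k             <⟨ +-mono-≤-< (m≤m+n m 0) (≤-trans k<m (m≤m+n m 1)) ⟩
    (m + 0) + (m + 1) ≡⟨ cong₂ _+_ (δ-leaf (<-trans (n<1+n 0) 1<m)) (δ-leaf 1<m) ⟨
    δ 0 + δ 1         ≡⟨ δ-node 1<m ⟨
    δ (m + 0)         ≡⟨ cong δ (trans (+-identityʳ m) (sym 1+k≡m)) ⟩
    δ (suc k)         ∎
    where
    open ≤-Reasoning
    k<m : k < m
    k<m = subst (k <_) 1+k≡m (n<1+n k)

  δ-increasing-node : ∀ {t} → suc (suc t) < m → (∀ {j} → j < m + t → δ j < δ (suc j)) →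
                      δ (m + t) < δ (suc (m + t))
  δ-increasing-node {t} 2+t<m δ-increasing-below = begin-strict
    δ (m + t)                           ≡⟨ δ-node 1+t<m ⟩
    δ (2 * t) + δ (1 + 2 * t)           <⟨ +-mono-< (<-trans (below (m≤n+m _ 2)) (below (m≤n+m _ 1)))
                                                    (<-trans (below (m≤n+m _ 1)) (below ≤-refl)) ⟩
    δ (2 + 2 * t) + δ (3 + 2 * t)       ≡⟨ cong (λ s → δ s + δ (suc s)) (*-suc 2 t) ⟨
    δ (2 * suc t) + δ (suc (2 * suc t)) ≡⟨ δ-node 2+t<m ⟨
    δ (m + suc t)                       ≡⟨ cong δ (+-suc m t) ⟩
    δ (suc (m + t))                     ∎
    where
    open ≤-Reasoning
    1+t<m : suc t < m
    1+t<m = <-trans (n<1+n _) 2+t<m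
    below : ∀ {j} → j ≤ 2 + 2 * t → δ j < δ (suc j)
    below j≤2+2t = δ-increasing-below (≤-<-trans j≤2+2t (c+t<m⇒c+2t<m+t 2 2+t<m))

  δ-increasing : ∀ k → suc (suc k) < 2 * m → δ k < δ (suc k)
  δ-increasing = <-rec _ step
    where
    step : ∀ k → (∀ {j} → j < k → suc (suc j) < 2 * m → δ j < δ (suc j)) →
           suc (suc k) < 2 * m → δ k < δ (suc k)
    step k below 2+k<2m with m ≤? k
    ... | no m≰k with m≤n⇒m<n∨m≡n (≰⇒> m≰k)
    ...   | inj₁ 1+k<m = δ-increasing-leaf 1+k<m
    ...   | inj₂ 1+k≡m = δ-increasing-boundary 1+k≡m
                           (m+n<2m⇒n<m (subst (_< 2 * m) (trans (cong suc 1+k≡m) (+-comm 1 m)) 2+k<2m))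
    step k below 2+k<2m | yes m≤k with t , refl ← m≤n⇒∃[o]m+o≡n m≤k =
      δ-increasing-node (m+n<2m⇒n<m (subst (_< 2 * m) 2+m+t≡m+2+t 2+k<2m))
                        (λ j<k → below j<k (<-trans (s<s (s<s j<k)) 2+k<2m))
      where
      2+m+t≡m+2+t : suc (suc (m + t)) ≡ m + suc (suc t)
      2+m+t≡m+2+t = sym (trans (+-suc m (suc t)) (cong suc (+-suc m t)))

  δ-pos : 0 < m → ∀ k → suc k < 2 * m → 0 < δ k
  δ-pos 0<m zero    _      = subst (0 <_) (sym (δ-leaf 0<m)) (<-≤-trans 0<m (m≤m+n m 0))
  δ-pos 0<m (suc k) 2+k<2m = <-trans (δ-pos 0<m k (<-trans (n<1+n _) 2+k<2m)) (δ-increasing k 2+k<2m)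

  a : ℕ → ℕ
  a zero    = 0
  a (suc k) = a k + δ k

  a-mono-≤ : ∀ {i j} → i ≤ j → a i ≤ a j
  a-mono-≤ {j = zero}  z≤n = ≤-refl
  a-mono-≤ {j = suc j} i≤1+j with m≤n⇒m<n∨m≡n i≤1+j
  ... | inj₁ i<1+j = ≤-trans (a-mono-≤ (s≤s⁻¹ i<1+j)) (m≤m+n (a j) (δ j))
  ... | inj₂ refl  = ≤-refl

  a-mono-< : 0 < m → ∀ {i j} → i < j → j < 2 * m → a i < a j
  a-mono-< 0<m {i} {suc j} i<1+j 1+j<2m =
    ≤-<-trans (a-mono-≤ (s≤s⁻¹ i<1+j)) (m<m+n (a j) (δ-pos 0<m j 1+j<2m))

  a-node : ∀ {t} → t < m → a (m + t) ≡ a (2 * t) + a m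
  a-node {zero}  _     = cong a (+-identityʳ m)
  a-node {suc t} 1+t<m = begin
    a (m + suc t)                                   ≡⟨ cong a (+-suc m t) ⟩
    a (m + t) + δ (m + t)                           ≡⟨ cong₂ _+_ (a-node (<-trans (n<1+n t) 1+t<m)) (δ-node 1+t<m) ⟩
    (a (2 * t) + a m) + (δ (2 * t) + δ (1 + 2 * t)) ≡⟨ regroup (a (2 * t)) (a m) (δ (2 * t)) (δ (1 + 2 * t)) ⟩
    a (2 + 2 * t) + a m                             ≡⟨ cong (λ s → a s + a m) (*-suc 2 t) ⟨
    a (2 * suc t) + a m                             ∎
    where
    open ≡-Reasoning
    regroup : ∀ x y u v → (x + y) + (u + v) ≡ ((x + u) + v) + y
    regroup = solve-∀

  A : Fin (2 * m) → ℤ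
  A i = + a (toℕ i)

  d : ℤ
  d = + a m

  A-isConvexSet : 0 < m → IsConvexSet A
  A-isConvexSet 0<m = increasing , convex
    where
    increasing : StrictlyIncreasing A
    increasing i j i<j = ℤ.+<+ (a-mono-< 0<m i<j (toℕ<n j))
    gap : ∀ x → + a (suc x) ℤ.- + a x ≡ + δ x
    gap x = +[m+n]-+m≡+n (a x) (δ x)
    convex-ℕ : ∀ {x y z} → y ≡ suc x → z ≡ suc y → z < 2 * m →
               + a y ℤ.- + a x ℤ.< + a z ℤ.- + a y
    convex-ℕ {x} refl refl 2+x<2m =
      subst₂ ℤ._<_ (sym (gap x)) (sym (gap (suc x))) (ℤ.+<+ (δ-increasing x 2+x<2m))
    convex : ConvexDiffs A
    convex i j k j≡1+i k≡1+j = convex-ℕ j≡1+i k≡1+j (toℕ<n k)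

  d≢0 : 0 < m → d ≢ 0ℤ
  d≢0 0<m d≡0 = ℤ.<⇒≢ (ℤ.+<+ (a-mono-< 0<m 0<m m<2m)) (sym d≡0)
    where
    m<2m : m < 2 * m
    m<2m = m<m+n m (<-≤-trans 0<m (m≤m+n m 0))

  m+t<2m : (t : Fin m) → m + toℕ t < 2 * m
  m+t<2m t = n<m⇒m+n<2m (toℕ<n t)

  2t<2m : (t : Fin m) → 2 * toℕ t < 2 * m
  2t<2m t = *-monoʳ-< 2 (toℕ<n t)

  d-pair : Fin m → Fin (2 * m) × Fin (2 * m)
  d-pair t = fromℕ< (m+t<2m t) , fromℕ< (2t<2m t)

  d-pair-diff : ∀ t → A (proj₁ (d-pair t)) ℤ.- A (proj₂ (d-pair t)) ≡ d
  d-pair-diff t = begin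
    + a (toℕ (proj₁ (d-pair t))) ℤ.- + a (toℕ (proj₂ (d-pair t)))
      ≡⟨ cong₂ (λ x y → + a x ℤ.- + a y) (toℕ-fromℕ< (m+t<2m t)) (toℕ-fromℕ< (2t<2m t)) ⟩
    + a (m + toℕ t) ℤ.- + a (2 * toℕ t)
      ≡⟨ cong (λ x → + x ℤ.- + a (2 * toℕ t)) (a-node (toℕ<n t)) ⟩
    + (a (2 * toℕ t) + a m) ℤ.- + a (2 * toℕ t)
      ≡⟨ +[m+n]-+m≡+n (a (2 * toℕ t)) (a m) ⟩
    d ∎
    where open ≡-Reasoning

  d-pair-injective : Injective _≡_ _≡_ d-pair
  d-pair-injective {s} {t} eq = toℕ-injective (+-cancelˡ-≡ m _ _ (begin
    m + toℕ s              ≡⟨ toℕ-fromℕ< (m+t<2m s) ⟨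
    toℕ (proj₁ (d-pair s)) ≡⟨ cong (toℕ ∘ proj₁) eq ⟩
    toℕ (proj₁ (d-pair t)) ≡⟨ toℕ-fromℕ< (m+t<2m t) ⟩
    m + toℕ t              ∎))
    where open ≡-Reasoning

  d∈A-A : 0 < m → InDiffSet A d
  d∈A-A 0<m = proj₁ (d-pair t₀) , proj₂ (d-pair t₀) , d-pair-diff t₀
    where t₀ = fromℕ< 0<m

  m≤rDiff : m ≤ rDiff A d
  m≤rDiff = injective⇒≤-length d-pair d-pair-injective λ t →
    ∈-filter⁺ _ (∈-cartesianProduct⁺ (∈-allFin _) (∈-allFin _)) (d-pair-diff t)

theorem1 : (m : ℕ) → 1 ≤ m →
    Σ (Fin (2 * m) → ℤ) λ a → IsConvexSet a ×
      ∃ λ (d : ℤ) → d ≢ 0ℤ × InDiffSet a d × m ≤ rDiff a d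
theorem1 m 0<m = A , A-isConvexSet 0<m , d , d≢0 0<m , d∈A-A 0<m , m≤rDiff
  where open Construction m
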